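{- Let $b\ge 2$ and $n\ge1$. There is a bijection between edge-labeled multigraphs without loops having $n$ edges (labeled $1,\dots,n$) on $b$ vertices, and juggling card sequences $A$ of length $n$ using cards $C_{i,j}$ with $1\le i<j\le b$ in which every one of the $b$ balls is thrown at least once and $\pi_A=\mathrm{id}$.
   Context: There are $b$ balls on levels $1,\dots,b$. For $1\le i<j\le b$ the card $C_{i,j}$ induces the permutation $\pi$ of $[b]$ with $\pi(1)=i$, $\pi(2)=j$, and $\pi$ restricted to $\{3,\dots,b\}$ the order-preserving bijection onto $[b]\setminus\{i,j\}$ (a ball at left level $t$ ends at right level $\pi(t)$); the balls thrown at the card are those at left levels $1$ and $2$ (so two balls are caught and thrown and their relative order is preserved). For $A=C^{(1)}\cdots C^{(n)}$, starting with ball $t$ at level $t$ and passing through the cards left to right, $\pi_A(t)$ is the final level of ball $t$. The multigraphs are counted with unlabeled vertices (up to isomorphism preserving edge labels), with distinct labels $1,\dots,n$ on the edges, parallel edges allowed, no loops, and every vertex incident to at least one edge. -}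

module Defs where

open import Data.Nat using (ℕ; zero; suc; _<ᵇ_)
open import Data.Bool using (if_then_else_)
open import Data.Fin using (Fin; toℕ) renaming (_<_ to _<ꟳ_)
open import Data.Fin.Permutation using (Permutation′; _⟨$⟩ʳ_)
open import Data.Vec using (Vec; []; _∷_; lookup)
open import Data.Vec.Relation.Unary.All using (All)
open import Data.Vec.Relation.Unary.Any using (Any)
open import Data.Product using (Σ; ∃; _×_; proj₁; proj₂)
open import Data.Sum using (_⊎_)
open import Data.Empty using (⊥)
open import Relation.Binary.PropositionalEquality using (_≡_)

-- Levels are 0-indexed: paper level t corresponds to ℕ value t - 1.

-- A pair (i , j) of elements of Fin b with i < j.  Used both for
-- (normalized, i.e. unordered) loopless edges and for cards C_{i,j}.
Pair : ℕ → Set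
Pair b = Fin b × Fin b

Ordered : ∀ {b} → Pair b → Set
Ordered p = proj₁ p <ꟳ proj₂ p

-- The permutation induced by card C_{i,j} (0-indexed levels):
-- 0 ↦ i, 1 ↦ j, and 2 + r ↦ the r-th (0-indexed) element of
-- ℕ \ {i, j} in increasing order (order-preserving onto [b] \ {i,j}).
cardPerm : ℕ → ℕ → ℕ → ℕ
cardPerm i j zero = i
cardPerm i j (suc zero) = j
cardPerm i j (suc (suc r)) =
  if r <ᵇ i then r else (if suc r <ᵇ j then suc r else suc (suc r))

applyCard : ∀ {b} → Pair b → ℕ → ℕ
applyCard c t = cardPerm (toℕ (proj₁ c)) (toℕ (proj₂ c)) t

πA : ∀ {b n} → Vec (Pair b) n → ℕ → ℕ
πA [] t = t
πA (c ∷ cs) t = πA cs (applyCard c t)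

-- The ball currently at level t is thrown at some card of the sequence,
-- i.e. it is at level 0 or 1 (paper: 1 or 2) just before that card.
Thrown : ∀ {b n} → Vec (Pair b) n → ℕ → Set
Thrown [] t = ⊥
Thrown (c ∷ cs) t = (t ≡ 0 ⊎ t ≡ 1) ⊎ Thrown cs (applyCard c t)

CardSeq : ℕ → ℕ → Set
CardSeq b n = Σ (Vec (Pair b) n) λ A →
  All Ordered A × ((t : Fin b) → Thrown A (toℕ t)) × ((t : Fin b) → πA A (toℕ t) ≡ toℕ t)

-- Edge with label k (k : Fin n) is the unordered pair {u , v}, stored
-- normalized as (u , v) with u < v (so no loops); parallel edges allowed;
-- every vertex is incident to some edge.
Multigraph : ℕ → ℕ → Set
Multigraph b n = Σ (Vec (Pair b) n) λ E →
  All Ordered E × ((x : Fin b) → Any (λ e → x ≡ proj₁ e ⊎ x ≡ proj₂ e) E)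

MapsEdge : ∀ {b} → Permutation′ b → Pair b → Pair b → Set
MapsEdge σ e e' =
  ((σ ⟨$⟩ʳ proj₁ e) ≡ proj₁ e' × (σ ⟨$⟩ʳ proj₂ e) ≡ proj₂ e')
  ⊎ ((σ ⟨$⟩ʳ proj₁ e) ≡ proj₂ e' × (σ ⟨$⟩ʳ proj₂ e) ≡ proj₁ e')

Iso : ∀ {b n} → Multigraph b n → Multigraph b n → Set
Iso {b} {n} G H = ∃ λ (σ : Permutation′ b) →
  (k : Fin n) → MapsEdge σ (lookup (proj₁ G) k) (lookup (proj₁ H) k)

-- The throw word of a ball records, card by card, whether the ball is thrown.
-- Order lemma: ball s starts below ball t iff (word of s, final level of s) is
-- lexicographically below that of t, "thrown" counting as smaller.  Hence in a
-- valid sequence (π_A = id) the throw words increase with the ball, and a valid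
-- sequence is determined by its throw words (sequence-from-keys).
-- The graph of a sequence has as edge k the two balls thrown at card k, so the
-- incidence word of a vertex is the throw word of its ball.  Conversely, reading
-- an edge list from its last edge backwards produces cards throwing exactly its
-- edges (cardsFor); when the incidence words are sorted every ball starts and
-- ends at its own level, so these cards form a valid sequence.  Every multigraph
-- is isomorphic to a sorted one, and isomorphic sorted multigraphs coincide since
-- a sorted family is determined by its multiset of values (sorted-permutation).
module Submission where

open import Defs
open import Data.Bool using (Bool; true; false; T)
open import Data.Bool.Properties using (T-≡; ⇔→≡)
open import Data.Empty using (⊥-elim)
import Data.Fin as Fin
open import Data.Fin using (Fin; toℕ; fromℕ<; inject≤) renaming (_<_ to _<ᶠ_; _≤_ to _≤ᶠ_)
import Data.Fin.Properties as Finₚ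
open import Data.Fin.Permutation
  using (Permutation′; permutation; _⟨$⟩ʳ_; _⟨$⟩ˡ_; inverseˡ; inverseʳ; flip; _∘ₚ_)
open import Data.Nat
open import Data.Nat.Properties
open import Data.Product using (Σ; ∃; _×_; _,_; proj₁; proj₂)
open import Data.Sum using (_⊎_; inj₁; inj₂; swap)
open import Data.Sum.Function.Propositional using (_⊎-⇔_)
open import Data.Unit using (tt)
open import Data.Vec using (Vec; []; _∷_; lookup)
open import Data.Vec.Properties using (∷-injectiveˡ; ∷-injectiveʳ)
open import Data.Vec.Relation.Unary.All using (All; []; _∷_)
open import Data.Vec.Relation.Unary.Any using (Any; here; there)
open import Function using (_∘_; _$_)
open import Function.Definitions using (Injective)
open import Function.Bundles using (_⇔_; mk⇔; Equivalence)
import Function.Related.Propositional as Related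
open import Function.Properties.Equivalence using () renaming (trans to ⇔-trans; sym to ⇔-sym)
open import Relation.Binary.Core using (Rel)
open import Relation.Binary.Definitions using (Transitive; Trichotomous; Tri; tri<; tri≈; tri>)
open import Relation.Binary.PropositionalEquality
open import Relation.Nullary using (¬_; Dec; yes; no; contradiction)
open import Relation.Nullary.Decidable using (_⊎-dec_; isYes; toWitness; fromWitness)

open Equivalence using (to; from)

<⇒<ᵇ≡true : ∀ {m n} → m < n → (m <ᵇ n) ≡ true
<⇒<ᵇ≡true m<n = to T-≡ (<⇒<ᵇ m<n)

≥⇒<ᵇ≡false : ∀ {m n} → n ≤ m → (m <ᵇ n) ≡ false
≥⇒<ᵇ≡false {m} {n} n≤m with m <ᵇ n in m<ᵇn
... | false = refl
... | true  = contradiction (<ᵇ⇒< m n (subst T (sym m<ᵇn) tt)) (≤⇒≯ n≤m)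

-- How card C_{i,j} moves a ball that is not thrown, i.e. one at level 2 + r:
-- the passive balls keep their order and fill ℕ ∖ {i , j} from below.
data Passive (i j r : ℕ) : Set where
  under   : r < i → cardPerm i j (2 + r) ≡ r → Passive i j r
  between : i ≤ r → suc r < j → cardPerm i j (2 + r) ≡ suc r → Passive i j r
  over    : i ≤ r → j ≤ suc r → cardPerm i j (2 + r) ≡ 2 + r → Passive i j r

passive : ∀ i j r → Passive i j r
passive i j r with r <? i | suc r <? j
... | yes r<i | _ = under r<i (if-under r<i)
  where
  if-under : r < i → cardPerm i j (2 + r) ≡ r
  if-under r<i rewrite <⇒<ᵇ≡true r<i = refl
... | no r≮i | yes sr<j = between (≮⇒≥ r≮i) sr<j (if-between (≮⇒≥ r≮i) sr<j)
  where
  if-between : i ≤ r → suc r < j → cardPerm i j (2 + r) ≡ suc r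
  if-between i≤r sr<j rewrite ≥⇒<ᵇ≡false i≤r | <⇒<ᵇ≡true sr<j = refl
... | no r≮i | no sr≮j = over (≮⇒≥ r≮i) (≮⇒≥ sr≮j) (if-over (≮⇒≥ r≮i) (≮⇒≥ sr≮j))
  where
  if-over : i ≤ r → j ≤ suc r → cardPerm i j (2 + r) ≡ 2 + r
  if-over i≤r j≤sr rewrite ≥⇒<ᵇ≡false i≤r | ≥⇒<ᵇ≡false j≤sr = refl

cardInv : ℕ → ℕ → ℕ → ℕ
cardInv i j ℓ with <-cmp ℓ i
... | tri< _ _ _ = 2 + ℓ
... | tri≈ _ _ _ = 0
... | tri> _ _ _ with <-cmp ℓ j
...   | tri< _ _ _ = suc ℓ
...   | tri≈ _ _ _ = 1
...   | tri> _ _ _ = ℓ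

cardInv-under : ∀ {i j ℓ} → ℓ < i → cardInv i j ℓ ≡ 2 + ℓ
cardInv-under {i} {j} {ℓ} ℓ<i with <-cmp ℓ i
... | tri< _ _ _ = refl
... | tri≈ ℓ≮i _ _ = contradiction ℓ<i ℓ≮i
... | tri> ℓ≮i _ _ = contradiction ℓ<i ℓ≮i

cardInv-i : ∀ {i j} → cardInv i j i ≡ 0
cardInv-i {i} {j} with <-cmp i i
... | tri< _ i≢i _ = contradiction refl i≢i
... | tri≈ _ _ _ = refl
... | tri> _ i≢i _ = contradiction refl i≢i

cardInv-between : ∀ {i j ℓ} → i < ℓ → ℓ < j → cardInv i j ℓ ≡ suc ℓ
cardInv-between {i} {j} {ℓ} i<ℓ ℓ<j with <-cmp ℓ i
... | tri< _ _ ℓ≯i = contradiction i<ℓ ℓ≯i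
... | tri≈ _ _ ℓ≯i = contradiction i<ℓ ℓ≯i
... | tri> _ _ _ with <-cmp ℓ j
...   | tri< _ _ _ = refl
...   | tri≈ ℓ≮j _ _ = contradiction ℓ<j ℓ≮j
...   | tri> ℓ≮j _ _ = contradiction ℓ<j ℓ≮j

cardInv-j : ∀ {i j} → i < j → cardInv i j j ≡ 1
cardInv-j {i} {j} i<j with <-cmp j i
... | tri< _ _ j≯i = contradiction i<j j≯i
... | tri≈ _ _ j≯i = contradiction i<j j≯i
... | tri> _ _ _ with <-cmp j j
...   | tri< _ j≢j _ = contradiction refl j≢j
...   | tri≈ _ _ _ = refl
...   | tri> _ j≢j _ = contradiction refl j≢j

cardInv-over : ∀ {i j ℓ} → i < j → j < ℓ → cardInv i j ℓ ≡ ℓ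
cardInv-over {i} {j} {ℓ} i<j j<ℓ with <-cmp ℓ i
... | tri< _ _ ℓ≯i = contradiction (<-trans i<j j<ℓ) ℓ≯i
... | tri≈ _ _ ℓ≯i = contradiction (<-trans i<j j<ℓ) ℓ≯i
... | tri> _ _ _ with <-cmp ℓ j
...   | tri< _ _ ℓ≯j = contradiction j<ℓ ℓ≯j
...   | tri≈ _ _ ℓ≯j = contradiction j<ℓ ℓ≯j
...   | tri> _ _ _ = refl

data Position (i j ℓ : ℕ) : Set where
  below-i : ℓ < i → Position i j ℓ
  at-i    : ℓ ≡ i → Position i j ℓ
  inside  : i < ℓ → ℓ < j → Position i j ℓ
  at-j    : ℓ ≡ j → Position i j ℓ
  above-j : j < ℓ → Position i j ℓ

position : ∀ i j ℓ → Position i j ℓ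
position i j ℓ with <-cmp ℓ i | <-cmp ℓ j
... | tri< ℓ<i _ _ | _            = below-i ℓ<i
... | tri≈ _ ℓ≡i _ | _            = at-i ℓ≡i
... | tri> _ _ i<ℓ | tri< ℓ<j _ _ = inside i<ℓ ℓ<j
... | tri> _ _ _   | tri≈ _ ℓ≡j _ = at-j ℓ≡j
... | tri> _ _ _   | tri> _ _ j<ℓ = above-j j<ℓ

cardPerm-cardInv : ∀ {i j} → i < j → ∀ ℓ → cardPerm i j (cardInv i j ℓ) ≡ ℓ
cardPerm-cardInv {i} {j} i<j ℓ with position i j ℓ
... | below-i ℓ<i rewrite cardInv-under {j = j} ℓ<i with passive i j ℓ
...   | under _ e = e
...   | between i≤ℓ _ _ = contradiction i≤ℓ (<⇒≱ ℓ<i)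
...   | over i≤ℓ _ _ = contradiction i≤ℓ (<⇒≱ ℓ<i)
cardPerm-cardInv {i} {j} i<j ℓ | at-i refl rewrite cardInv-i {ℓ} {j} = refl
cardPerm-cardInv {i} {j} i<j (suc r) | inside i<ℓ ℓ<j
  rewrite cardInv-between i<ℓ ℓ<j with passive i j r
...   | under r<i _ = contradiction (≤-pred i<ℓ) (<⇒≱ r<i)
...   | between _ _ e = e
...   | over _ j≤ℓ _ = contradiction j≤ℓ (<⇒≱ ℓ<j)
cardPerm-cardInv {i} {j} i<j ℓ | at-j refl rewrite cardInv-j i<j = refl
cardPerm-cardInv {i} {j} i<j (suc zero) | above-j j<ℓ =
  contradiction (<-≤-trans i<j (≤-pred j<ℓ)) (λ ())
cardPerm-cardInv {i} {j} i<j (suc (suc r)) | above-j j<ℓ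
  rewrite cardInv-over i<j j<ℓ with passive i j r
... | under r<i _ = contradiction (≤-pred (<-≤-trans i<j (≤-pred j<ℓ))) (<⇒≱ r<i)
... | between _ sr<j _ = contradiction (≤-pred j<ℓ) (<⇒≱ sr<j)
... | over _ _ e = e

cardInv-cardPerm : ∀ {i j} → i < j → ∀ t → cardInv i j (cardPerm i j t) ≡ t
cardInv-cardPerm {i} {j} i<j zero = cardInv-i {i} {j}
cardInv-cardPerm {i} {j} i<j (suc zero) = cardInv-j i<j
cardInv-cardPerm {i} {j} i<j (suc (suc r)) with passive i j r
... | under r<i e rewrite e = cardInv-under r<i
... | between i≤r sr<j e rewrite e = cardInv-between (s≤s i≤r) sr<j
... | over _ j≤sr e rewrite e = cardInv-over i<j (s≤s j≤sr)

cardPerm-bound : ∀ {i j b} → i < j → j < b → ∀ {t} → t < b → cardPerm i j t < b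
cardPerm-bound i<j j<b {zero} _ = <-trans i<j j<b
cardPerm-bound i<j j<b {suc zero} _ = j<b
cardPerm-bound {i} {j} i<j j<b {suc (suc r)} t<b with passive i j r
... | under _ e rewrite e = <-trans (n<1+n r) (<-trans (n<1+n (suc r)) t<b)
... | between _ sr<j e rewrite e = <-trans sr<j j<b
... | over _ _ e rewrite e = t<b

cardInv-bound : ∀ {i j b} → i < j → j < b → ∀ {ℓ} → ℓ < b → cardInv i j ℓ < b
cardInv-bound {i} {j} i<j j<b {ℓ} ℓ<b with position i j ℓ
... | below-i ℓ<i rewrite cardInv-under {j = j} ℓ<i = ≤-<-trans (≤-trans (s≤s ℓ<i) i<j) j<b
... | at-i refl rewrite cardInv-i {ℓ} {j} = ≤-<-trans z≤n ℓ<b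
... | inside i<ℓ ℓ<j rewrite cardInv-between i<ℓ ℓ<j = ≤-<-trans ℓ<j j<b
... | at-j refl rewrite cardInv-j i<j = ≤-<-trans (≤-trans (s≤s z≤n) i<j) j<b
... | above-j j<ℓ rewrite cardInv-over i<j j<ℓ = ℓ<b

cardPerm-mono : ∀ {i j r q} → r < q → cardPerm i j (2 + r) < cardPerm i j (2 + q)
cardPerm-mono {i} {j} {r} {q} r<q with passive i j r | passive i j q
... | under _ e     | under _ e'     rewrite e | e' = r<q
... | under _ e     | between _ _ e' rewrite e | e' = m<n⇒m<1+n r<q
... | under _ e     | over _ _ e'    rewrite e | e' = m<n⇒m<1+n (m<n⇒m<1+n r<q)
... | between i≤r _ _ | under q<i _  = contradiction (<-≤-trans q<i i≤r) (<⇒≯ r<q)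
... | between _ _ e | between _ _ e' rewrite e | e' = s≤s r<q
... | between _ _ e | over _ _ e'    rewrite e | e' = s≤s (m<n⇒m<1+n r<q)
... | over i≤r _ _  | under q<i _    = contradiction (<-≤-trans q<i i≤r) (<⇒≯ r<q)
... | over _ j≤sr _ | between _ sq<j _ = contradiction (<-≤-trans sq<j j≤sr) (<⇒≯ (s≤s r<q))
... | over _ _ e    | over _ _ e'    rewrite e | e' = s≤s (s≤s r<q)

T-<ᵇ2 : ∀ t → T (t <ᵇ 2) ⇔ (t ≡ 0 ⊎ t ≡ 1)
T-<ᵇ2 zero = mk⇔ (λ _ → inj₁ refl) (λ _ → tt)
T-<ᵇ2 (suc zero) = mk⇔ (λ _ → inj₂ refl) (λ _ → tt)
T-<ᵇ2 (suc (suc t)) = mk⇔ (λ ()) λ { (inj₁ ()) ; (inj₂ ()) }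

cardInv-thrown : ∀ {i j} → i < j → ∀ ℓ → (cardInv i j ℓ ≡ 0 ⊎ cardInv i j ℓ ≡ 1) ⇔ (ℓ ≡ i ⊎ ℓ ≡ j)
cardInv-thrown {i} {j} i<j ℓ = mk⇔ thrown-here thrown-before
  where
  back : ∀ {t} → cardInv i j ℓ ≡ t → ℓ ≡ cardPerm i j t
  back eq = trans (sym (cardPerm-cardInv i<j ℓ)) (cong (cardPerm i j) eq)
  thrown-here : cardInv i j ℓ ≡ 0 ⊎ cardInv i j ℓ ≡ 1 → ℓ ≡ i ⊎ ℓ ≡ j
  thrown-here (inj₁ eq) = inj₁ (back eq)
  thrown-here (inj₂ eq) = inj₂ (back eq)
  thrown-before : ℓ ≡ i ⊎ ℓ ≡ j → cardInv i j ℓ ≡ 0 ⊎ cardInv i j ℓ ≡ 1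
  thrown-before (inj₁ refl) = inj₁ (cardInv-i {i} {j})
  thrown-before (inj₂ refl) = inj₂ (cardInv-j i<j)

record IsArrangement {b} (M : Fin b → ℕ) : Set where
  field
    bounded    : ∀ x → M x < b
    injective  : ∀ {x y} → M x ≡ M y → x ≡ y
    surjective : ∀ {ℓ} → ℓ < b → ∃ λ x → M x ≡ ℓ
open IsArrangement

toℕ-arrangement : ∀ {b} → IsArrangement {b} toℕ
toℕ-arrangement = record
  { bounded    = Finₚ.toℕ<n
  ; injective  = Finₚ.toℕ-injective
  ; surjective = λ ℓ<b → fromℕ< ℓ<b , Finₚ.toℕ-fromℕ< ℓ<b
  }

∘-arrangement : ∀ {b} {M : Fin b → ℕ} (h h⁻¹ : ℕ → ℕ)
  → (∀ ℓ → h⁻¹ (h ℓ) ≡ ℓ) → (∀ ℓ → h (h⁻¹ ℓ) ≡ ℓ)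
  → (∀ {ℓ} → ℓ < b → h ℓ < b) → (∀ {ℓ} → ℓ < b → h⁻¹ ℓ < b)
  → IsArrangement M → IsArrangement (h ∘ M)
∘-arrangement {M = M} h h⁻¹ h⁻¹∘h h∘h⁻¹ h-bound h⁻¹-bound M-arr = record
  { bounded    = λ x → h-bound (bounded M-arr x)
  ; injective  = λ {x} {y} eq → injective M-arr $
      trans (sym (h⁻¹∘h (M x))) (trans (cong h⁻¹ eq) (h⁻¹∘h (M y)))
  ; surjective = λ ℓ<b →
      let (x , Mx≡) = surjective M-arr (h⁻¹-bound ℓ<b)
      in x , trans (cong h Mx≡) (h∘h⁻¹ _)
  }

unapplyCard : ∀ {b} → Pair b → ℕ → ℕ
unapplyCard c = cardInv (toℕ (proj₁ c)) (toℕ (proj₂ c))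

throw-arrangement : ∀ {b} {M : Fin b → ℕ} {c : Pair b} → Ordered c
  → IsArrangement M → IsArrangement (applyCard c ∘ M)
throw-arrangement {c = _ , j} i<j = ∘-arrangement _ _
  (cardInv-cardPerm i<j) (cardPerm-cardInv i<j)
  (cardPerm-bound i<j (Finₚ.toℕ<n j)) (cardInv-bound i<j (Finₚ.toℕ<n j))

unthrow-arrangement : ∀ {b} {M : Fin b → ℕ} {c : Pair b} → Ordered c
  → IsArrangement M → IsArrangement (unapplyCard c ∘ M)
unthrow-arrangement {c = _ , j} i<j = ∘-arrangement _ _
  (cardPerm-cardInv i<j) (cardInv-cardPerm i<j)
  (cardInv-bound i<j (Finₚ.toℕ<n j)) (cardPerm-bound i<j (Finₚ.toℕ<n j))

-- If L' preserves the order of the arrangement L then L ≤ L' pointwise: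
-- the ball at level ℓ has ℓ balls below it in L, hence also in L'.
arrangement-≤ : ∀ {b} {L L' : Fin b → ℕ} → IsArrangement L
  → (∀ {x y} → L x < L y → L' x < L' y) → ∀ x → L x ≤ L' x
arrangement-≤ {b} {L} {L'} L-arr mono x = go (L x) x refl
  where
  go : ∀ ℓ x → L x ≡ ℓ → ℓ ≤ L' x
  go zero x _ = z≤n
  go (suc ℓ) x Lx≡ =
    let (y , Ly≡) = surjective L-arr (<-trans (n<1+n ℓ) (subst (_< b) Lx≡ (bounded L-arr x)))
    in ≤-trans (s≤s (go ℓ y Ly≡)) (mono (subst₂ _<_ (sym Ly≡) (sym Lx≡) (n<1+n ℓ)))

arrangements-equal : ∀ {b} {L L' : Fin b → ℕ} → IsArrangement L → IsArrangement L'
  → (∀ {x y} → L x < L y ⇔ L' x < L' y) → ∀ x → L x ≡ L' x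
arrangements-equal L-arr L'-arr same-order x =
  ≤-antisym (arrangement-≤ L-arr (to same-order) x) (arrangement-≤ L'-arr (from same-order) x)

-- Lexicographic order on words, with true ("thrown") below false.
data _≺_ : ∀ {n} → Vec Bool n → Vec Bool n → Set where
  head< : ∀ {n} {u v : Vec Bool n} → (true ∷ u) ≺ (false ∷ v)
  tail< : ∀ {n a} {u v : Vec Bool n} → u ≺ v → (a ∷ u) ≺ (a ∷ v)

≺-irrefl : ∀ {n} {u : Vec Bool n} → ¬ u ≺ u
≺-irrefl (tail< p) = ≺-irrefl p

≺-trans : ∀ {n} → Transitive (_≺_ {n})
≺-trans head<     (tail< _) = head<
≺-trans (tail< _) head<     = head<
≺-trans (tail< p) (tail< q) = tail< (≺-trans p q)

≺-asym : ∀ {n} {u v : Vec Bool n} → u ≺ v → ¬ v ≺ u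
≺-asym p q = ≺-irrefl (≺-trans p q)

≺-tail : ∀ {n a} {u v : Vec Bool n} → (a ∷ u) ≺ (a ∷ v) → u ≺ v
≺-tail (tail< p) = p

tri-cons : ∀ {n a} {u v : Vec Bool n} → Tri (u ≺ v) (u ≡ v) (v ≺ u)
  → Tri ((a ∷ u) ≺ (a ∷ v)) (a ∷ u ≡ a ∷ v) ((a ∷ v) ≺ (a ∷ u))
tri-cons (tri< p ¬q ¬r) = tri< (tail< p) (¬q ∘ ∷-injectiveʳ) (¬r ∘ ≺-tail)
tri-cons (tri≈ ¬p refl ¬r) = tri≈ (¬p ∘ ≺-tail) refl (¬r ∘ ≺-tail)
tri-cons (tri> ¬p ¬q r) = tri> (¬p ∘ ≺-tail) (¬q ∘ ∷-injectiveʳ) (tail< r)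

≺-compare : ∀ {n} → Trichotomous _≡_ (_≺_ {n})
≺-compare [] [] = tri≈ (λ ()) refl (λ ())
≺-compare (true ∷ u)  (false ∷ v) = tri< head< (λ ()) (λ ())
≺-compare (false ∷ u) (true ∷ v)  = tri> (λ ()) (λ ()) head<
≺-compare (true ∷ u)  (true ∷ v)  = tri-cons (≺-compare u v)
≺-compare (false ∷ u) (false ∷ v) = tri-cons (≺-compare u v)

Key : ℕ → Set
Key n = Vec Bool n × ℕ

_⊏_ : ∀ {n} → Key n → Key n → Set
(u , p) ⊏ (v , q) = u ≺ v ⊎ (u ≡ v × p < q)

⊏-asym : ∀ {n} {k k' : Key n} → k ⊏ k' → ¬ k' ⊏ k
⊏-asym (inj₁ u≺v)         (inj₁ v≺u)         = ≺-asym u≺v v≺u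
⊏-asym (inj₁ u≺v)         (inj₂ (refl , _))  = ≺-irrefl u≺v
⊏-asym (inj₂ (refl , _))  (inj₁ v≺u)         = ≺-irrefl v≺u
⊏-asym (inj₂ (_ , p<q))   (inj₂ (_ , q<p))   = <-asym p<q q<p

⊏-cons : ∀ {n a} {u v : Vec Bool n} {p q} → (u , p) ⊏ (v , q) → (a ∷ u , p) ⊏ (a ∷ v , q)
⊏-cons (inj₁ u≺v) = inj₁ (tail< u≺v)
⊏-cons (inj₂ (refl , p<q)) = inj₂ (refl , p<q)

throws : ∀ {b n} → Vec (Pair b) n → ℕ → Vec Bool n
throws [] t = []
throws (c ∷ cs) t = (t <ᵇ 2) ∷ throws cs (applyCard c t)

key : ∀ {b n} → Vec (Pair b) n → ℕ → Key n
key A t = throws A t , πA A t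

consKey : ∀ {n} → Bool → Key n → Key (suc n)
consKey a (u , p) = a ∷ u , p

-- A thrown ball lands below every passive one, thrown balls keep their order
-- (i < j), and passive balls keep theirs (cardPerm-mono).
order-preserved : ∀ {b n} {A : Vec (Pair b) n} → All Ordered A
  → ∀ {s t} → s < t → key A s ⊏ key A t
order-preserved [] s<t = inj₂ (refl , s<t)
order-preserved (i<j ∷ os) {zero} {suc zero} _ = ⊏-cons (order-preserved os i<j)
order-preserved (_ ∷ _) {zero} {suc (suc _)} _ = inj₁ head<
order-preserved (_ ∷ _) {suc zero} {suc (suc _)} _ = inj₁ head<
order-preserved {A = (i , j) ∷ _} (_ ∷ os) {suc (suc _)} {suc (suc _)} (s≤s (s≤s r<q)) =
  ⊏-cons (order-preserved os (cardPerm-mono {toℕ i} {toℕ j} r<q))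
order-preserved (_ ∷ _) {suc zero} {suc zero} (s≤s ())
order-preserved (_ ∷ _) {suc (suc _)} {suc zero} (s≤s ())

order-reflected : ∀ {b n} {A : Vec (Pair b) n} → All Ordered A
  → ∀ {s t} → key A s ⊏ key A t → s < t
order-reflected os {s} {t} s⊏t with <-cmp s t
... | tri< s<t _ _ = s<t
... | tri≈ _ refl _ = contradiction s⊏t (⊏-asym s⊏t)
... | tri> _ _ t<s = contradiction s⊏t (⊏-asym (order-preserved os t<s))

thrown⇔ : ∀ {b n} (A : Vec (Pair b) n) t → Thrown A t ⇔ Any T (throws A t)
thrown⇔ [] t = mk⇔ (λ ()) (λ ())
thrown⇔ (c ∷ cs) t = mk⇔ forth back
  where
  forth : Thrown (c ∷ cs) t → Any T (throws (c ∷ cs) t)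
  forth (inj₁ low) = here (from (T-<ᵇ2 t) low)
  forth (inj₂ later) = there (to (thrown⇔ cs _) later)
  back : Any T (throws (c ∷ cs) t) → Thrown (c ∷ cs) t
  back (here low) = inj₁ (to (T-<ᵇ2 t) low)
  back (there later) = inj₂ (from (thrown⇔ cs _) later)

Sorted : ∀ {a r} {A : Set a} → Rel A r → ∀ {b} → (Fin b → A) → Set r
Sorted _<_ W = ∀ {x y} → x <ᶠ y → ¬ W y < W x

module SortedPermutation {a r} {A : Set a} {_<_ : Rel A r}
  (<-trans′ : Transitive _<_) (compare : Trichotomous _≡_ _<_) where

  irrefl : ∀ {u} → ¬ u < u
  irrefl {u} u<u with compare u u
  ... | tri< _ _ ¬u<u = ¬u<u u<u
  ... | tri≈ ¬u<u _ _ = ¬u<u u<u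
  ... | tri> ¬u<u _ _ = ¬u<u u<u

  value<⇒position< : ∀ {b} {W : Fin b → A} → Sorted _<_ W → ∀ {z x} → W z < W x → z <ᶠ x
  value<⇒position< sorted {z} {x} Wz<Wx with Finₚ.<-cmp z x
  ... | tri< z<x _ _ = z<x
  ... | tri≈ _ refl _ = contradiction Wz<Wx irrefl
  ... | tri> _ _ x<z = contradiction Wz<Wx (sorted x<z)

  prefix-below : ∀ {b} {W : Fin b → A} → Sorted _<_ W → ∀ {y x c} → y ≤ᶠ x → W x < c → W y < c
  prefix-below {W = W} sorted {y} {x} y≤x Wx<c with Finₚ.<-cmp y x
  ... | tri≈ _ refl _ = Wx<c
  ... | tri> _ _ x<y = contradiction y≤x (<⇒≱ x<y)
  ... | tri< y<x _ _ with compare (W y) (W x)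
  ...   | tri< Wy<Wx _ _ = <-trans′ Wy<Wx Wx<c
  ...   | tri≈ _ Wy≡Wx _ = subst (_< _) (sym Wy≡Wx) Wx<c
  ...   | tri> _ _ Wx<Wy = contradiction Wx<Wy (sorted y<x)

  -- If W' = W ∘ σ⁻¹ had W' x < W x, then σ⁻¹ would map the x + 1 positions
  -- up to x injectively to the x positions below x.
  no-descent : ∀ {b} {W W' : Fin b → A} → Sorted _<_ W → Sorted _<_ W'
    → (σ : Permutation′ b) → (∀ z → W' (σ ⟨$⟩ʳ z) ≡ W z) → ∀ x → ¬ W' x < W x
  no-descent {b} {W} {W'} W-sorted W'-sorted σ W'σ≡W x W'x<Wx =
    Finₚ.<⇒notInjective ≤-refl squeeze-injective
    where
    x+1≤b : suc (toℕ x) ≤ b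
    x+1≤b = Finₚ.toℕ<n x
    prefix : Fin (suc (toℕ x)) → Fin b
    prefix y = inject≤ y x+1≤b
    prefix≤x : ∀ y → prefix y ≤ᶠ x
    prefix≤x y = subst (_≤ toℕ x) (sym (Finₚ.toℕ-inject≤ y x+1≤b)) (≤-pred (Finₚ.toℕ<n y))
    source<x : ∀ y → σ ⟨$⟩ˡ prefix y <ᶠ x
    source<x y = value<⇒position< W-sorted $
      subst (_< W x) (trans (cong W' (sym (inverseʳ σ))) (W'σ≡W _))
            (prefix-below W'-sorted (prefix≤x y) W'x<Wx)
    squeeze : Fin (suc (toℕ x)) → Fin (toℕ x)
    squeeze y = fromℕ< (source<x y)
    squeeze-injective : Injective _≡_ _≡_ squeeze
    squeeze-injective {y} {y'} eq = Finₚ.inject≤-injective x+1≤b x+1≤b y y' $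
      trans (sym (inverseʳ σ)) (trans (cong (σ ⟨$⟩ʳ_) same-source) (inverseʳ σ))
      where
      same-source : σ ⟨$⟩ˡ prefix y ≡ σ ⟨$⟩ˡ prefix y'
      same-source = Finₚ.toℕ-injective $
        trans (sym (Finₚ.toℕ-fromℕ< (source<x y))) (trans (cong toℕ eq) (Finₚ.toℕ-fromℕ< (source<x y')))

  sorted-permutation : ∀ {b} {W W' : Fin b → A} → Sorted _<_ W → Sorted _<_ W'
    → (σ : Permutation′ b) → (∀ z → W' (σ ⟨$⟩ʳ z) ≡ W z) → ∀ x → W x ≡ W' x
  sorted-permutation {W = W} {W'} W-sorted W'-sorted σ W'σ≡W x with compare (W x) (W' x)
  ... | tri≈ _ Wx≡W'x _ = Wx≡W'x
  ... | tri> _ _ W'x<Wx = contradiction W'x<Wx (no-descent W-sorted W'-sorted σ W'σ≡W x)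
  ... | tri< Wx<W'x _ _ = contradiction Wx<W'x (no-descent W'-sorted W-sorted (flip σ) Wσ⁻¹≡W' x)
    where
    Wσ⁻¹≡W' : ∀ z → W (σ ⟨$⟩ˡ z) ≡ W' z
    Wσ⁻¹≡W' z = trans (sym (W'σ≡W _)) (cong W' (inverseʳ σ))

Sorted-resp : ∀ {a r} {A : Set a} {_<_ : Rel A r} {b} {W W' : Fin b → A}
  → (∀ x → W x ≡ W' x) → Sorted _<_ W → Sorted _<_ W'
Sorted-resp {_<_ = _<_} W≡W' sorted {x} {y} x<y =
  subst₂ (λ u v → ¬ u < v) (W≡W' y) (W≡W' x) (sorted x<y)

-- The throw words of the balls of a card sequence, named by their starting
-- levels, are sorted: a lower ball has a key below, hence a word not above.
throws-sorted : ∀ {b n} {A : Vec (Pair b) n} → All Ordered A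
  → Sorted _≺_ (λ (x : Fin b) → throws A (toℕ x))
throws-sorted {A = A} os x<y with order-preserved {A = A} os x<y
... | inj₁ wx≺wy       = ≺-asym wx≺wy
... | inj₂ (wx≡wy , _) = subst (λ w → ¬ _ ≺ w) (sym wx≡wy) ≺-irrefl

sorted-key : ∀ {b n} {W : Fin b → Vec Bool n} → Sorted _≺_ W
  → ∀ {x y} → (W x , toℕ x) ⊏ (W y , toℕ y) ⇔ x <ᶠ y
sorted-key {W = W} sorted {x} {y} = mk⇔ forth back
  where
  forth : (W x , toℕ x) ⊏ (W y , toℕ y) → x <ᶠ y
  forth (inj₁ Wx≺Wy) = SortedPermutation.value<⇒position< ≺-trans ≺-compare sorted Wx≺Wy
  forth (inj₂ (_ , x<y)) = x<y
  back : x <ᶠ y → (W x , toℕ x) ⊏ (W y , toℕ y)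
  back x<y with ≺-compare (W x) (W y)
  ... | tri< Wx≺Wy _ _ = inj₁ Wx≺Wy
  ... | tri≈ _ Wx≡Wy _ = inj₂ (Wx≡Wy , x<y)
  ... | tri> _ _ Wy≺Wx = contradiction Wy≺Wx (sorted x<y)

_∈ₑ_ : ∀ {b} → Fin b → Pair b → Set
x ∈ₑ e = x ≡ proj₁ e ⊎ x ≡ proj₂ e

_∈ₑ?_ : ∀ {b} (x : Fin b) (e : Pair b) → Dec (x ∈ₑ e)
x ∈ₑ? e = (x Finₚ.≟ proj₁ e) ⊎-dec (x Finₚ.≟ proj₂ e)

sortPair : ∀ {b} → Fin b → Fin b → Pair b
sortPair x y with x Finₚ.<? y
... | yes _ = x , y
... | no _  = y , x

sortPair-∈ : ∀ {b} {x y z : Fin b} → z ∈ₑ sortPair x y ⇔ (z ≡ x ⊎ z ≡ y)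
sortPair-∈ {x = x} {y} with x Finₚ.<? y
... | yes _ = mk⇔ (λ m → m) (λ m → m)
... | no _  = mk⇔ swap swap

sortPair-ordered : ∀ {b} {x y : Fin b} → x ≢ y → Ordered (sortPair x y)
sortPair-ordered {x = x} {y} x≢y with x Finₚ.<? y
... | yes x<y = x<y
... | no x≮y with Finₚ.<-cmp x y
...   | tri< x<y _ _ = contradiction x<y x≮y
...   | tri≈ _ x≡y _ = contradiction x≡y x≢y
...   | tri> _ _ y<x = y<x

ordered-pair-ext : ∀ {b} {e e' : Pair b} → Ordered e → Ordered e'
  → proj₁ e ∈ₑ e' → proj₂ e ∈ₑ e' → e ≡ e'
ordered-pair-ext e₁<e₂ _ (inj₁ refl) (inj₂ refl) = refl
ordered-pair-ext e₁<e₂ _ (inj₁ refl) (inj₁ e₂≡) = contradiction (cong toℕ e₂≡) (<⇒≢ e₁<e₂ ∘ sym)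
ordered-pair-ext e₁<e₂ _ (inj₂ refl) (inj₂ e₂≡) = contradiction (cong toℕ e₂≡) (<⇒≢ e₁<e₂ ∘ sym)
ordered-pair-ext e₁<e₂ e'₁<e'₂ (inj₂ refl) (inj₁ refl) = ⊥-elim (<-asym e₁<e₂ e'₁<e'₂)

incident : ∀ {b} → Fin b → Pair b → Bool
incident x e = isYes (x ∈ₑ? e)

T-incident : ∀ {b} {x : Fin b} {e : Pair b} → T (incident x e) ⇔ x ∈ₑ e
T-incident = mk⇔ toWitness fromWitness

incidence : ∀ {b n} → Vec (Pair b) n → Fin b → Vec Bool n
incidence [] x = []
incidence (e ∷ es) x = incident x e ∷ incidence es x

covered⇔ : ∀ {b n} (E : Vec (Pair b) n) x → Any (x ∈ₑ_) E ⇔ Any T (incidence E x)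
covered⇔ [] x = mk⇔ (λ ()) (λ ())
covered⇔ (e ∷ es) x = mk⇔ forth back
  where
  forth : Any (x ∈ₑ_) (e ∷ es) → Any T (incidence (e ∷ es) x)
  forth (here x∈e) = here (from T-incident x∈e)
  forth (there later) = there (to (covered⇔ es x) later)
  back : Any T (incidence (e ∷ es) x) → Any (x ∈ₑ_) (e ∷ es)
  back (here x∈e) = here (to T-incident x∈e)
  back (there later) = there (from (covered⇔ es x) later)

bit-ext : ∀ {p q : Bool} → T p ⇔ T q → p ≡ q
bit-ext p⇔q = ⇔→≡ (⇔-trans (⇔-sym T-≡) (⇔-trans p⇔q T-≡))

incident-ext : ∀ {b} {x y : Fin b} {e e' : Pair b} → x ∈ₑ e ⇔ y ∈ₑ e' → incident x e ≡ incident y e'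
incident-ext same = bit-ext (⇔-trans T-incident (⇔-trans same (⇔-sym T-incident)))

incidence-ext : ∀ {b n} {E E' : Vec (Pair b) n} → All Ordered E → All Ordered E'
  → (∀ x → incidence E x ≡ incidence E' x) → E ≡ E'
incidence-ext [] [] _ = refl
incidence-ext {E = e ∷ es} {e' ∷ es'} (o ∷ os) (o' ∷ os') same =
  cong₂ _∷_ (ordered-pair-ext o o' (in-e' (inj₁ refl)) (in-e' (inj₂ refl)))
            (incidence-ext os os' (∷-injectiveʳ ∘ same))
  where
  in-e' : ∀ {x} → x ∈ₑ e → x ∈ₑ e'
  in-e' {x} x∈e = to T-incident (subst T (∷-injectiveˡ (same x)) (from T-incident x∈e))

σ-injective : ∀ {b} (σ : Permutation′ b) {x y} → σ ⟨$⟩ʳ x ≡ σ ⟨$⟩ʳ y → x ≡ y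
σ-injective σ {x} {y} eq = trans (sym (inverseˡ σ)) (trans (cong (σ ⟨$⟩ˡ_) eq) (inverseˡ σ))

MapsEdge-∈ : ∀ {b} {σ : Permutation′ b} {e e' : Pair b} → MapsEdge σ e e'
  → ∀ {x} → x ∈ₑ e ⇔ (σ ⟨$⟩ʳ x) ∈ₑ e'
MapsEdge-∈ {σ = σ} maps = mk⇔ (forth maps) (back maps)
  where
  forth : ∀ {e e' x} → MapsEdge σ e e' → x ∈ₑ e → (σ ⟨$⟩ʳ x) ∈ₑ e'
  forth (inj₁ (p , _)) (inj₁ refl) = inj₁ p
  forth (inj₁ (_ , q)) (inj₂ refl) = inj₂ q
  forth (inj₂ (p , _)) (inj₁ refl) = inj₂ p
  forth (inj₂ (_ , q)) (inj₂ refl) = inj₁ q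
  back : ∀ {e e' x} → MapsEdge σ e e' → (σ ⟨$⟩ʳ x) ∈ₑ e' → x ∈ₑ e
  back (inj₁ (p , _)) (inj₁ m) = inj₁ (σ-injective σ (trans m (sym p)))
  back (inj₁ (_ , q)) (inj₂ m) = inj₂ (σ-injective σ (trans m (sym q)))
  back (inj₂ (_ , q)) (inj₁ m) = inj₂ (σ-injective σ (trans m (sym q)))
  back (inj₂ (p , _)) (inj₂ m) = inj₁ (σ-injective σ (trans m (sym p)))

maps-incidence : ∀ {b n} {σ : Permutation′ b} {E E' : Vec (Pair b) n}
  → (∀ k → MapsEdge σ (lookup E k) (lookup E' k))
  → ∀ x → incidence E' (σ ⟨$⟩ʳ x) ≡ incidence E x
maps-incidence {E = []} {[]} maps x = refl
maps-incidence {σ = σ} {E = e ∷ es} {e' ∷ es'} maps x =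
  cong₂ _∷_ (incident-ext (⇔-sym (MapsEdge-∈ {σ = σ} (maps Fin.zero))))
            (maps-incidence {σ = σ} {E = es} {es'} (maps ∘ Fin.suc) x)

relabel : ∀ {b n} → Permutation′ b → Vec (Pair b) n → Vec (Pair b) n
relabel σ [] = []
relabel σ (e ∷ es) = sortPair (σ ⟨$⟩ʳ proj₁ e) (σ ⟨$⟩ʳ proj₂ e) ∷ relabel σ es

relabel-ordered : ∀ {b n} (σ : Permutation′ b) {E : Vec (Pair b) n} → All Ordered E → All Ordered (relabel σ E)
relabel-ordered σ [] = []
relabel-ordered σ (e₁<e₂ ∷ os) =
  sortPair-ordered (λ eq → <-irrefl (cong toℕ (σ-injective σ eq)) e₁<e₂) ∷ relabel-ordered σ os

relabel-maps : ∀ {b n} (σ : Permutation′ b) (E : Vec (Pair b) n) k → MapsEdge σ (lookup E k) (lookup (relabel σ E) k)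
relabel-maps σ (e ∷ es) (Fin.suc k) = relabel-maps σ es k
relabel-maps σ ((x , y) ∷ es) Fin.zero with (σ ⟨$⟩ʳ x) Finₚ.<? (σ ⟨$⟩ʳ y)
... | yes _ = inj₁ (refl , refl)
... | no _  = inj₂ (refl , refl)

record _≅_ {b n} (E E' : Vec (Pair b) n) : Set where
  constructor relabelling
  field
    perm : Permutation′ b
    maps : ∀ k → MapsEdge perm (lookup E k) (lookup E' k)

≅-sym : ∀ {b n} {E E' : Vec (Pair b) n} → E ≅ E' → E' ≅ E
≅-sym (relabelling σ maps) = relabelling (flip σ) λ k → back (maps k)
  where
  back : ∀ {e e'} → MapsEdge σ e e' → MapsEdge (flip σ) e' e
  back (inj₁ (p , q)) = inj₁ (trans (cong (σ ⟨$⟩ˡ_) (sym p)) (inverseˡ σ) , trans (cong (σ ⟨$⟩ˡ_) (sym q)) (inverseˡ σ))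
  back (inj₂ (p , q)) = inj₂ (trans (cong (σ ⟨$⟩ˡ_) (sym q)) (inverseˡ σ) , trans (cong (σ ⟨$⟩ˡ_) (sym p)) (inverseˡ σ))

≅-trans : ∀ {b n} {E E' E'' : Vec (Pair b) n} → E ≅ E' → E' ≅ E'' → E ≅ E''
≅-trans (relabelling σ σ-maps) (relabelling τ τ-maps) = relabelling (σ ∘ₚ τ) λ k → compose (σ-maps k) (τ-maps k)
  where
  compose : ∀ {e e' e''} → MapsEdge σ e e' → MapsEdge τ e' e'' → MapsEdge (σ ∘ₚ τ) e e''
  compose (inj₁ (p , q)) (inj₁ (r , s)) = inj₁ (trans (cong (τ ⟨$⟩ʳ_) p) r , trans (cong (τ ⟨$⟩ʳ_) q) s)
  compose (inj₁ (p , q)) (inj₂ (r , s)) = inj₂ (trans (cong (τ ⟨$⟩ʳ_) p) r , trans (cong (τ ⟨$⟩ʳ_) q) s)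
  compose (inj₂ (p , q)) (inj₁ (r , s)) = inj₂ (trans (cong (τ ⟨$⟩ʳ_) p) s , trans (cong (τ ⟨$⟩ʳ_) q) r)
  compose (inj₂ (p , q)) (inj₂ (r , s)) = inj₁ (trans (cong (τ ⟨$⟩ʳ_) p) s , trans (cong (τ ⟨$⟩ʳ_) q) r)

module Correspondence {b : ℕ} (1<b : 1 < b) where

  0<b : 0 < b
  0<b = <-trans z<s 1<b

  -- A card is determined by where it sends the levels 0 and 1.
  card-from-arrangement : ∀ {M : Fin b → ℕ} {c c' : Pair b} → IsArrangement M
    → (∀ x → applyCard c (M x) ≡ applyCard c' (M x)) → c ≡ c'
  card-from-arrangement {M} {c} {c'} M-arr agree =
    cong₂ _,_ (Finₚ.toℕ-injective (agree-at 0<b)) (Finₚ.toℕ-injective (agree-at 1<b))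
    where
    agree-at : ∀ {ℓ} → ℓ < b → applyCard c ℓ ≡ applyCard c' ℓ
    agree-at ℓ<b with surjective M-arr ℓ<b
    ... | x , refl = agree x

  -- Two sequences of cards are equal if, started from the same arrangement,
  -- every ball gets the same key in both: by the order lemma the balls are
  -- then in the same order after the first card, so the first cards agree.
  sequence-from-keys : ∀ {n} {A A' : Vec (Pair b) n} {M : Fin b → ℕ}
    → All Ordered A → All Ordered A' → IsArrangement M
    → (∀ x → key A (M x) ≡ key A' (M x)) → A ≡ A'
  sequence-from-keys [] [] _ _ = refl
  sequence-from-keys {A = c ∷ cs} {c' ∷ cs'} {M} (o ∷ os) (o' ∷ os') M-arr same-key =
    cong₂ _∷_ (card-from-arrangement M-arr same-level)
              (sequence-from-keys os os' (throw-arrangement o M-arr) same-key′)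
    where
    L L' : Fin b → ℕ
    L  = applyCard c  ∘ M
    L' = applyCard c' ∘ M
    same-tail-key : ∀ x → key cs (L x) ≡ key cs' (L' x)
    same-tail-key x = cong₂ _,_ (∷-injectiveʳ (cong proj₁ (same-key x))) (cong proj₂ (same-key x))
    same-order : ∀ {x y} → L x < L y ⇔ L' x < L' y
    same-order {x} {y} = mk⇔
      (λ lt → order-reflected os' (subst₂ _⊏_ (same-tail-key x) (same-tail-key y) (order-preserved os lt)))
      (λ lt → order-reflected os (subst₂ _⊏_ (sym (same-tail-key x)) (sym (same-tail-key y)) (order-preserved os' lt)))
    same-level : ∀ x → L x ≡ L' x
    same-level = arrangements-equal (throw-arrangement o M-arr) (throw-arrangement o' M-arr) same-order
    same-key′ : ∀ x → key cs (L x) ≡ key cs' (L x)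
    same-key′ x = trans (same-tail-key x) (cong (key cs') (sym (same-level x)))

  -- The ball at level ℓ under M (an arbitrary ball if there is none).
  ballAt : (Fin b → ℕ) → ℕ → Fin b
  ballAt M ℓ with Finₚ.any? (λ x → M x ≟ ℓ)
  ... | yes (x , _) = x
  ... | no _        = fromℕ< 0<b

  ballAt-unique : ∀ {M : Fin b → ℕ} {ℓ} → IsArrangement M → ℓ < b → ∀ {x} → x ≡ ballAt M ℓ ⇔ M x ≡ ℓ
  ballAt-unique {M} {ℓ} M-arr ℓ<b = mk⇔ (λ { refl → at-ℓ }) (λ Mx≡ℓ → injective M-arr (trans Mx≡ℓ (sym at-ℓ)))
    where
    at-ℓ : M (ballAt M ℓ) ≡ ℓ
    at-ℓ with Finₚ.any? (λ x → M x ≟ ℓ)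
    ... | yes (_ , Mx≡ℓ) = Mx≡ℓ
    ... | no none = contradiction (surjective M-arr ℓ<b) none

  thrownPair : (Fin b → ℕ) → Pair b
  thrownPair M = sortPair (ballAt M 0) (ballAt M 1)

  thrownPair-ordered : ∀ {M : Fin b → ℕ} → IsArrangement M → Ordered (thrownPair M)
  thrownPair-ordered M-arr = sortPair-ordered λ eq →
    0≢1+n (trans (sym (to (ballAt-unique M-arr 0<b) refl)) (to (ballAt-unique M-arr 1<b) eq))

  ∈-thrownPair : ∀ {M : Fin b → ℕ} → IsArrangement M → ∀ {x} → x ∈ₑ thrownPair M ⇔ T (M x <ᵇ 2)
  ∈-thrownPair {M} M-arr {x} = begin
    x ∈ₑ thrownPair M                   ∼⟨ sortPair-∈ ⟩
    (x ≡ ballAt M 0 ⊎ x ≡ ballAt M 1)   ∼⟨ ballAt-unique M-arr 0<b ⊎-⇔ ballAt-unique M-arr 1<b ⟩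
    (M x ≡ 0 ⊎ M x ≡ 1)                 ∼⟨ ⇔-sym (T-<ᵇ2 (M x)) ⟩
    T (M x <ᵇ 2)                        ∎
    where open Related.EquationalReasoning

  graphEdges : ∀ {n} → Vec (Pair b) n → (Fin b → ℕ) → Vec (Pair b) n
  graphEdges [] M = []
  graphEdges (c ∷ cs) M = thrownPair M ∷ graphEdges cs (applyCard c ∘ M)

  graphEdges-ordered : ∀ {n} {A : Vec (Pair b) n} {M : Fin b → ℕ} → All Ordered A
    → IsArrangement M → All Ordered (graphEdges A M)
  graphEdges-ordered [] M-arr = []
  graphEdges-ordered (o ∷ os) M-arr =
    thrownPair-ordered M-arr ∷ graphEdges-ordered os (throw-arrangement o M-arr)

  graphEdges-incidence : ∀ {n} {A : Vec (Pair b) n} {M : Fin b → ℕ} → All Ordered A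
    → IsArrangement M → ∀ x → incidence (graphEdges A M) x ≡ throws A (M x)
  graphEdges-incidence [] M-arr x = refl
  graphEdges-incidence (o ∷ os) M-arr x =
    cong₂ _∷_ (bit-ext (⇔-trans T-incident (∈-thrownPair M-arr)))
              (graphEdges-incidence os (throw-arrangement o M-arr) x)

  graphOf : ∀ {n} → CardSeq b n → Multigraph b n
  graphOf (A , os , thrown , _) = graphEdges A toℕ , graphEdges-ordered os toℕ-arrangement , covered
    where
    covered : ∀ x → Any (x ∈ₑ_) (graphEdges A toℕ)
    covered x = from (covered⇔ _ x) $
      subst (Any T) (sym (graphEdges-incidence os toℕ-arrangement x)) (to (thrown⇔ A _) (thrown x))

  -- Level m as an element of Fin b (an arbitrary one if m ≥ b).
  levelFin : ℕ → Fin b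
  levelFin m with m <? b
  ... | yes m<b = fromℕ< m<b
  ... | no _    = fromℕ< 0<b

  toℕ-levelFin : ∀ {m} → m < b → toℕ (levelFin m) ≡ m
  toℕ-levelFin {m} m<b with m <? b
  ... | yes m<b′ = Finₚ.toℕ-fromℕ< m<b′
  ... | no m≮b   = contradiction m<b m≮b

  level≡⇔ : ∀ {m} {i : Fin b} → m < b → m ≡ toℕ i ⇔ levelFin m ≡ i
  level≡⇔ m<b = mk⇔ (λ m≡i → Finₚ.toℕ-injective (trans (toℕ-levelFin m<b) m≡i))
                    (λ m≡i → trans (sym (toℕ-levelFin m<b)) (cong toℕ m≡i))

  same-levelFin⇔ : ∀ {M : Fin b → ℕ} → IsArrangement M → ∀ {x y} → levelFin (M x) ≡ levelFin (M y) ⇔ x ≡ y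
  same-levelFin⇔ M-arr = mk⇔
    (λ eq → injective M-arr (trans (sym (toℕ-levelFin (bounded M-arr _))) (trans (cong toℕ eq) (toℕ-levelFin (bounded M-arr _)))))
    (cong (levelFin ∘ _))

  cardFor : (Fin b → ℕ) → Pair b → Pair b
  cardFor M (x , y) = sortPair (levelFin (M x)) (levelFin (M y))

  cardFor-ordered : ∀ {M : Fin b → ℕ} {e} → IsArrangement M → Ordered e → Ordered (cardFor M e)
  cardFor-ordered M-arr x<y = sortPair-ordered λ eq → <-irrefl (cong toℕ (to (same-levelFin⇔ M-arr) eq)) x<y

  unthrown-cardFor : ∀ {M : Fin b → ℕ} {e} → IsArrangement M → (o : Ordered e)
    → ∀ x → T (unapplyCard (cardFor M e) (M x) <ᵇ 2) ⇔ x ∈ₑ e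
  unthrown-cardFor {M} {e} M-arr o x = begin
    T (cardInv i j (M x) <ᵇ 2)
      ∼⟨ T-<ᵇ2 _ ⟩
    (cardInv i j (M x) ≡ 0 ⊎ cardInv i j (M x) ≡ 1)
      ∼⟨ cardInv-thrown (cardFor-ordered M-arr o) (M x) ⟩
    (M x ≡ i ⊎ M x ≡ j)
      ∼⟨ level≡⇔ (bounded M-arr x) ⊎-⇔ level≡⇔ (bounded M-arr x) ⟩
    levelFin (M x) ∈ₑ cardFor M e
      ∼⟨ sortPair-∈ ⟩
    (levelFin (M x) ≡ levelFin (M (proj₁ e)) ⊎ levelFin (M x) ≡ levelFin (M (proj₂ e)))
      ∼⟨ same-levelFin⇔ M-arr ⊎-⇔ same-levelFin⇔ M-arr ⟩
    x ∈ₑ e ∎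
    where
    open Related.EquationalReasoning
    i j : ℕ
    i = toℕ (proj₁ (cardFor M e))
    j = toℕ (proj₂ (cardFor M e))

  -- Reading an edge list from its last edge backwards: startLevels E x is the
  -- level from which the ball ending at level x must start so that the cards
  -- cardsFor E throw, at card k, exactly the two balls of edge k.
  startLevels : ∀ {n} → Vec (Pair b) n → Fin b → ℕ
  startLevels [] = toℕ
  startLevels (e ∷ es) = unapplyCard (cardFor (startLevels es) e) ∘ startLevels es

  cardsFor : ∀ {n} → Vec (Pair b) n → Vec (Pair b) n
  cardsFor [] = []
  cardsFor (e ∷ es) = cardFor (startLevels es) e ∷ cardsFor es

  startLevels-arrangement : ∀ {n} {E : Vec (Pair b) n} → All Ordered E → IsArrangement (startLevels E)
  startLevels-arrangement [] = toℕ-arrangement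
  startLevels-arrangement (o ∷ os) =
    unthrow-arrangement (cardFor-ordered (startLevels-arrangement os) o) (startLevels-arrangement os)

  cardsFor-ordered : ∀ {n} {E : Vec (Pair b) n} → All Ordered E → All Ordered (cardsFor E)
  cardsFor-ordered [] = []
  cardsFor-ordered (o ∷ os) = cardFor-ordered (startLevels-arrangement os) o ∷ cardsFor-ordered os

  cardsFor-key : ∀ {n} {E : Vec (Pair b) n} → All Ordered E
    → ∀ x → key (cardsFor E) (startLevels E x) ≡ (incidence E x , toℕ x)
  cardsFor-key [] x = refl
  cardsFor-key {E = e ∷ es} (o ∷ os) x = begin
    key (cardsFor (e ∷ es)) (startLevels (e ∷ es) x)
      ≡⟨ cong (λ t → consKey (ℓ <ᵇ 2) (key (cardsFor es) t)) (cardPerm-cardInv c-ordered (M x)) ⟩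
    consKey (ℓ <ᵇ 2) (key (cardsFor es) (M x))
      ≡⟨ cong₂ consKey (bit-ext (⇔-trans (unthrown-cardFor M-arr o x) (⇔-sym T-incident))) (cardsFor-key os x) ⟩
    (incidence (e ∷ es) x , toℕ x) ∎
    where
    open ≡-Reasoning
    M = startLevels es
    M-arr = startLevels-arrangement os
    c-ordered = cardFor-ordered M-arr o
    ℓ = startLevels (e ∷ es) x

  SortedEdges : ∀ {n} → Vec (Pair b) n → Set
  SortedEdges E = Sorted _≺_ (incidence E)

  sorted⇒startLevels-id : ∀ {n} {E : Vec (Pair b) n} → All Ordered E → SortedEdges E
    → ∀ x → startLevels E x ≡ toℕ x
  sorted⇒startLevels-id {E = E} os sorted =
    arrangements-equal (startLevels-arrangement os) toℕ-arrangement same-order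
    where
    same-order : ∀ {x y} → startLevels E x < startLevels E y ⇔ x <ᶠ y
    same-order {x} {y} = mk⇔
      (λ lt → to (sorted-key sorted)
        (subst₂ _⊏_ (cardsFor-key os x) (cardsFor-key os y) (order-preserved (cardsFor-ordered os) lt)))
      (λ lt → order-reflected (cardsFor-ordered os)
        (subst₂ _⊏_ (sym (cardsFor-key os x)) (sym (cardsFor-key os y)) (from (sorted-key sorted) lt)))

  sorted-key-id : ∀ {n} {E : Vec (Pair b) n} → All Ordered E → SortedEdges E
    → ∀ x → key (cardsFor E) (toℕ x) ≡ (incidence E x , toℕ x)
  sorted-key-id {E = E} os sorted x =
    subst (λ t → key (cardsFor E) t ≡ _) (sorted⇒startLevels-id os sorted x) (cardsFor-key os x)

  realize : ∀ {n} (G : Multigraph b n) → SortedEdges (proj₁ G) → CardSeq b n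
  realize (E , os , covered) sorted = cardsFor E , cardsFor-ordered os , thrown , returns
    where
    thrown : ∀ x → Thrown (cardsFor E) (toℕ x)
    thrown x = from (thrown⇔ (cardsFor E) _) $
      subst (Any T) (sym (cong proj₁ (sorted-key-id os sorted x))) (to (covered⇔ E x) (covered x))
    returns : ∀ x → πA (cardsFor E) (toℕ x) ≡ toℕ x
    returns x = cong proj₂ (sorted-key-id os sorted x)

  graph-realize : ∀ {n} (G : Multigraph b n) (sorted : SortedEdges (proj₁ G))
    → graphEdges (proj₁ (realize G sorted)) toℕ ≡ proj₁ G
  graph-realize (_ , os , _) sorted = incidence-ext (graphEdges-ordered (cardsFor-ordered os) toℕ-arrangement) os λ x →
    trans (graphEdges-incidence (cardsFor-ordered os) toℕ-arrangement x) (cong proj₁ (sorted-key-id os sorted x))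

  graphOf-sorted : ∀ {n} (A : CardSeq b n) → SortedEdges (proj₁ (graphOf A))
  graphOf-sorted (A , os , _) =
    Sorted-resp {_<_ = _≺_} (λ x → sym (graphEdges-incidence os toℕ-arrangement x)) (throws-sorted os)

  realize-graphOf : ∀ {n} (A : CardSeq b n) → cardsFor (proj₁ (graphOf A)) ≡ proj₁ A
  realize-graphOf A@(A-cards , os , _ , returns) =
    sequence-from-keys (cardsFor-ordered (graphEdges-ordered os toℕ-arrangement)) os toℕ-arrangement λ x →
      trans (sorted-key-id (graphEdges-ordered os toℕ-arrangement) (graphOf-sorted A) x)
            (cong₂ _,_ (graphEdges-incidence os toℕ-arrangement x) (sym (returns x)))

  sorted-iso⇒≡ : ∀ {n} (G H : Multigraph b n) → SortedEdges (proj₁ G) → SortedEdges (proj₁ H)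
    → proj₁ G ≅ proj₁ H → proj₁ G ≡ proj₁ H
  sorted-iso⇒≡ (_ , G-ordered , _) (_ , H-ordered , _) G-sorted H-sorted (relabelling σ maps) =
    incidence-ext G-ordered H-ordered
      (SortedPermutation.sorted-permutation ≺-trans ≺-compare G-sorted H-sorted σ (maps-incidence {σ = σ} maps))

  levelPerm : ∀ {M : Fin b → ℕ} → IsArrangement M → Permutation′ b
  levelPerm {M} M-arr = permutation (levelFin ∘ M) (λ ℓ → ballAt M (toℕ ℓ)) right left
    where
    right : ∀ ℓ → levelFin (M (ballAt M (toℕ ℓ))) ≡ ℓ
    right ℓ = to (level≡⇔ (bounded M-arr _)) (to (ballAt-unique M-arr (Finₚ.toℕ<n ℓ)) refl)
    left : ∀ x → ballAt M (toℕ (levelFin (M x))) ≡ x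
    left x = sym (from (ballAt-unique M-arr (Finₚ.toℕ<n _)) (sym (toℕ-levelFin (bounded M-arr x))))

  -- Every multigraph is isomorphic to a sorted one: rename each vertex x by the
  -- level at which its ball starts under cardsFor.
  sortedForm : ∀ {n} (G : Multigraph b n) → Σ (Multigraph b n) λ H → SortedEdges (proj₁ H) × proj₁ G ≅ proj₁ H
  sortedForm (E , os , covered) = (E' , relabel-ordered σ os , covered') , sorted , relabelling σ (relabel-maps σ E)
    where
    σ : Permutation′ b
    σ = levelPerm (startLevels-arrangement os)
    E' : Vec (Pair b) _
    E' = relabel σ E
    -- vertex σ x of E' is ball x of cardsFor E, which starts at level toℕ (σ x)
    E'-incidence : ∀ x' → incidence E' x' ≡ incidence E (σ ⟨$⟩ˡ x')
    E'-incidence x' = trans (cong (incidence E') (sym (inverseʳ σ))) (maps-incidence {σ = σ} (relabel-maps σ E) _)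
    E'-throws : ∀ x' → incidence E' x' ≡ throws (cardsFor E) (toℕ x')
    E'-throws x' = begin
      incidence E' x'                                          ≡⟨ E'-incidence x' ⟩
      incidence E (σ ⟨$⟩ˡ x')                                  ≡˘⟨ cong proj₁ (cardsFor-key os _) ⟩
      throws (cardsFor E) (startLevels E (σ ⟨$⟩ˡ x'))          ≡˘⟨ cong (throws (cardsFor E)) (toℕ-levelFin (bounded (startLevels-arrangement os) _)) ⟩
      throws (cardsFor E) (toℕ (σ ⟨$⟩ʳ (σ ⟨$⟩ˡ x')))           ≡⟨ cong (throws (cardsFor E) ∘ toℕ) (inverseʳ σ) ⟩
      throws (cardsFor E) (toℕ x')                             ∎
      where open ≡-Reasoning
    sorted : SortedEdges E'
    sorted = Sorted-resp {_<_ = _≺_} (λ x' → sym (E'-throws x')) (throws-sorted (cardsFor-ordered os))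
    covered' : ∀ x' → Any (x' ∈ₑ_) E'
    covered' x' = from (covered⇔ E' x') $
      subst (Any T) (sym (E'-incidence x')) (to (covered⇔ E _) (covered (σ ⟨$⟩ˡ x')))

  canonical : ∀ {n} → Multigraph b n → Multigraph b n
  canonical G = proj₁ (sortedForm G)

  canonical-sorted : ∀ {n} (G : Multigraph b n) → SortedEdges (proj₁ (canonical G))
  canonical-sorted G = proj₁ (proj₂ (sortedForm G))

  canonical-iso : ∀ {n} (G : Multigraph b n) → proj₁ G ≅ proj₁ (canonical G)
  canonical-iso G = proj₂ (proj₂ (sortedForm G))

  canonical-≡ : ∀ {n} (G H : Multigraph b n) → proj₁ G ≅ proj₁ H → proj₁ (canonical G) ≡ proj₁ (canonical H)
  canonical-≡ G H G≅H =
    sorted-iso⇒≡ (canonical G) (canonical H) (canonical-sorted G) (canonical-sorted H)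
      (≅-trans (≅-sym (canonical-iso G)) (≅-trans G≅H (canonical-iso H)))

  toCards : ∀ {n} → Multigraph b n → CardSeq b n
  toCards G = realize (canonical G) (canonical-sorted G)

  toCards-respects-iso : ∀ {n} (G H : Multigraph b n) → Iso G H → proj₁ (toCards G) ≡ proj₁ (toCards H)
  toCards-respects-iso G H G≅H = cong cardsFor (canonical-≡ G H (relabelling (proj₁ G≅H) (proj₂ G≅H)))

  toCards-reflects-iso : ∀ {n} (G H : Multigraph b n) → proj₁ (toCards G) ≡ proj₁ (toCards H) → Iso G H
  toCards-reflects-iso G H same-cards =
    let relabelling σ maps = ≅-trans (canonical-iso G) (subst (_≅ proj₁ H) (sym same-canonical) (≅-sym (canonical-iso H)))
    in σ , maps
    where
    same-canonical : proj₁ (canonical G) ≡ proj₁ (canonical H)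
    same-canonical = begin
      proj₁ (canonical G)                      ≡˘⟨ graph-realize (canonical G) (canonical-sorted G) ⟩
      graphEdges (proj₁ (toCards G)) toℕ      ≡⟨ cong (λ A → graphEdges A toℕ) same-cards ⟩
      graphEdges (proj₁ (toCards H)) toℕ      ≡⟨ graph-realize (canonical H) (canonical-sorted H) ⟩
      proj₁ (canonical H)                      ∎
      where open ≡-Reasoning

  toCards-onto : ∀ {n} (A : CardSeq b n) → proj₁ (toCards (graphOf A)) ≡ proj₁ A
  toCards-onto A = begin
    cardsFor (proj₁ (canonical (graphOf A)))  ≡⟨ cong cardsFor (canonical-of-sorted (graphOf A) (graphOf-sorted A)) ⟩
    cardsFor (proj₁ (graphOf A))              ≡⟨ realize-graphOf A ⟩
    proj₁ A                                   ∎
    where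
    open ≡-Reasoning
    canonical-of-sorted : ∀ (G : Multigraph b _) → SortedEdges (proj₁ G) → proj₁ (canonical G) ≡ proj₁ G
    canonical-of-sorted G G-sorted =
      sorted-iso⇒≡ (canonical G) G (canonical-sorted G) G-sorted (≅-sym (canonical-iso G))

theorem3p1 : (b n : ℕ) → 2 ≤ b → 1 ≤ n →
    Σ (Multigraph b n → CardSeq b n) λ f →
    ((G H : Multigraph b n) → Iso G H → proj₁ (f G) ≡ proj₁ (f H))
    × ((G H : Multigraph b n) → proj₁ (f G) ≡ proj₁ (f H) → Iso G H)
    × ((A : CardSeq b n) → ∃ λ G → proj₁ (f G) ≡ proj₁ A)
theorem3p1 b n 2≤b _ =
  toCards , toCards-respects-iso , toCards-reflects-iso , λ A → graphOf A , toCards-onto A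
  where open Correspondence 2≤b
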